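{- $(15,0,6,1)\in\mathrm{IHWP}(45,15;3,5)$. That is, letting $V$ be a set of $45$ vertices and $W\subseteq V$ a subset of $15$ vertices, the edge set of $K_{45}$ on $V$ minus the edges of the complete graph on $W$ can be partitioned into $15$ $C_3$-factors of $K_{45}$ (each spanning all of $V$), $6$ holey $C_3$-factors and $1$ holey $C_5$-factor, where a holey factor covers exactly the $30$ vertices of $V\setminus W$.
   Context: A $C_k$-factor of a graph is a spanning subgraph all of whose components are cycles of length $k$. For $v-h$ even and $v$ odd, an $\mathrm{IHW}(v,h;m,n,\alpha,\beta,\alpha',\beta')$ is a decomposition of the edges of $K_v-E(K_h)$ (complete graph on $v$ vertices minus the edges of a complete subgraph on $h$ of its vertices, the "hole") into $\alpha$ $C_m$-factors and $\beta$ $C_n$-factors of $K_v$ and $\alpha'$ holey $C_m$-factors and $\beta'$ holey $C_n$-factors, where a holey $C_k$-factor is a 2-regular subgraph whose components are $k$-cycles covering exactly the vertices not in the hole, and $\alpha+\beta=\frac{v-h}{2}$, $\alpha'+\beta'=\lfloor\frac{h-1}{2}\rfloor$. $\mathrm{IHWP}(v,h;m,n)$ is the set of tuples $(\alpha,\beta,\alpha',\beta')$ for which such a decomposition exists. -}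

module Defs where

open import Data.Nat using (ℕ; _<_; _∸_; _+_)
open import Data.Nat.DivMod using (_/_)
open import Data.Fin using (Fin; toℕ; _≟_)
open import Data.Product using (_×_; _,_; proj₁; proj₂)
open import Data.Sum using (_⊎_)
open import Data.List using (List; []; _∷_; _++_; zip; concatMap; length; filter)
open import Data.List.Membership.Propositional using (_∈_)
open import Data.List.Relation.Unary.All using (All)
open import Data.List.Relation.Unary.Unique.Propositional using (Unique)
open import Data.Vec using (Vec; toList)
import Data.Vec as Vec
open import Function.Bundles using (_⇔_)
open import Relation.Nullary using (¬_; Dec; _×-dec_; _⊎-dec_)
open import Relation.Binary.PropositionalEquality using (_≡_; _≢_)

-- Vertices of K_v are Fin v; the hole W is {x | toℕ x < h}.
InHole : {v : ℕ} → ℕ → Fin v → Set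
InHole h x = toℕ x < h

-- A k-cycle is given by its cyclic sequence of k vertices (c₀,…,c_{k-1});
-- its edges are {cᵢ, c_{i+1 mod k}}.
cycleEdgesL : {v : ℕ} → List (Fin v) → List (Fin v × Fin v)
cycleEdgesL [] = []
cycleEdgesL (a ∷ as) = zip (a ∷ as) (as ++ (a ∷ []))

cycleEdges : {v k : ℕ} → Vec (Fin v) k → List (Fin v × Fin v)
cycleEdges c = cycleEdgesL (toList c)

Factor : ℕ → ℕ → Set
Factor v k = List (Vec (Fin v) k)

factorVertices : {v k : ℕ} → Factor v k → List (Fin v)
factorVertices F = concatMap toList F

factorEdges : {v k : ℕ} → Factor v k → List (Fin v × Fin v)
factorEdges F = concatMap cycleEdges F

-- F is a 2-regular subgraph whose components are k-cycles covering exactly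
-- the vertex set S: all listed vertices (over all cycles) are pairwise
-- distinct (so each cycle is a genuine k-cycle and the cycles are disjoint),
-- and the vertices covered are exactly those in S.
IsCycleFactorOn : {v k : ℕ} → (Fin v → Set) → Factor v k → Set
IsCycleFactorOn S F = Unique (factorVertices F) × (∀ x → (x ∈ factorVertices F) ⇔ S x)

IsFactor : {v k : ℕ} → Factor v k → Set
IsFactor F = IsCycleFactorOn (λ _ → ⊤') F
  where
  open import Data.Unit using () renaming (⊤ to ⊤')

IsHoleyFactor : {v k : ℕ} → ℕ → Factor v k → Set
IsHoleyFactor h F = IsCycleFactorOn (λ x → ¬ InHole h x) F

-- the (ordered pair) e represents the unordered edge {x,y}
SameEdge : {v : ℕ} → Fin v → Fin v → Fin v × Fin v → Set
SameEdge x y e = (proj₁ e ≡ x × proj₂ e ≡ y) ⊎ (proj₁ e ≡ y × proj₂ e ≡ x)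

sameEdge? : {v : ℕ} → (x y : Fin v) → (e : Fin v × Fin v) → Dec (SameEdge x y e)
sameEdge? x y e = ((proj₁ e ≟ x) ×-dec (proj₂ e ≟ y)) ⊎-dec ((proj₁ e ≟ y) ×-dec (proj₂ e ≟ x))

edgeCount : {v : ℕ} → Fin v → Fin v → List (Fin v × Fin v) → ℕ
edgeCount x y es = length (filter (sameEdge? x y) es)

-- IHW(v,h;m,n,α,β,α',β'): α C_m-factors, β C_n-factors, α' holey C_m-factors,
-- β' holey C_n-factors, whose edges partition E(K_v) ∖ E(K_h)
-- (every edge {x,y} of K_v not inside the hole lies in exactly one cycle of
-- exactly one factor, and edges inside the hole are used by none).
record IHW (v h m n α β α' β' : ℕ) : Set where
  field
    count-full  : α + β ≡ (v ∸ h) / 2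
    count-holey : α' + β' ≡ (h ∸ 1) / 2
    mFactors : Vec (Factor v m) α
    nFactors : Vec (Factor v n) β
    mHoley   : Vec (Factor v m) α'
    nHoley   : Vec (Factor v n) β'
    mFactors-ok : All IsFactor (toList mFactors)
    nFactors-ok : All IsFactor (toList nFactors)
    mHoley-ok   : All (IsHoleyFactor h) (toList mHoley)
    nHoley-ok   : All (IsHoleyFactor h) (toList nHoley)
  allEdges : List (Fin v × Fin v)
  allEdges = concatMap factorEdges (toList mFactors ++ toList mHoley)
          ++ concatMap factorEdges (toList nFactors ++ toList nHoley)
  field
    outside-hole : ∀ x y → x ≢ y → ¬ (InHole h x × InHole h y) → edgeCount x y allEdges ≡ 1
    inside-hole  : ∀ x y → InHole h x → InHole h y → edgeCount x y allEdges ≡ 0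

-- Take the vertices to be ℤ₁₅ × {0,1,2} with the hole ℤ₁₅ × {0}. The fifteen triangle
-- factors are the ℤ₁₅-orbit of one base factor; the six holey triangle factors are the
-- orbits of two base factors that are fixed by the rotation x ↦ x + 3, so each orbit has
-- length 3; the holey pentagon factor consists of the cosets of ⟨3⟩ on levels 1 and 2.
-- That these edge-disjointly cover exactly the edges meeting ℤ₁₅ × {1,2} is checked by
-- evaluation.

module Submission where

open import Defs
open import Level using (Level; 0ℓ)
open import Data.Nat using (ℕ; NonZero; _+_; _*_; _<?_)
import Data.Nat as ℕ
open import Data.Nat.DivMod using (_mod_)
open import Data.Fin using (Fin; #_; toℕ; _≟_; remQuot; combine)
open import Data.Fin.Properties using (all?)
open import Data.Product using (_×_; _,_; proj₁; proj₂)
open import Data.Sum using (_⊎_; inj₁; inj₂)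
open import Data.List using (List; []; _∷_; _++_; map; filter; concatMap; length)
open import Data.List.Properties using (filter-reject)
open import Data.List.Relation.Unary.All using ([])
import Data.List.Relation.Unary.All as All
import Data.List.Relation.Unary.Unique.DecPropositional as UniqueDec
import Data.List.Membership.DecPropositional as MembershipDec
open import Data.Vec using (Vec; _∷_; []; tabulate; toList) renaming (_++_ to _++ᵥ_)
import Data.Vec as Vec
open import Data.Unit using (tt)
open import Function using (_∘_)
open import Function.Bundles using (_⇔_; mk⇔; Equivalence)
open import Relation.Nullary using (¬_; Dec; yes; no; ¬?; _×-dec_; _→-dec_; _⊎-dec_)
open import Relation.Nullary.Decidable using (toWitness; map′)
open import Relation.Unary using (Pred; Decidable; _⊆_)
open import Relation.Binary.PropositionalEquality using (_≡_; _≢_; refl; cong; trans; sym; subst)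

private
  variable
    v k : ℕ

_⇔-dec_ : {A B : Set} → Dec A → Dec B → Dec (A ⇔ B)
a? ⇔-dec b? = map′ (λ (f , g) → mk⇔ f g) (λ e → Equivalence.to e , Equivalence.from e)
                   ((a? →-dec b?) ×-dec (b? →-dec a?))

isCycleFactorOn? : {S : Fin v → Set} → Decidable S → (F : Factor v k) → Dec (IsCycleFactorOn S F)
isCycleFactorOn? S? F =
  UniqueDec.unique? _≟_ (factorVertices F) ×-dec
  all? (λ x → MembershipDec._∈?_ _≟_ x (factorVertices F) ⇔-dec S? x)

isFactor? : (F : Factor v k) → Dec (IsFactor F)
isFactor? = isCycleFactorOn? (λ _ → yes tt)

isHoleyFactor? : (h : ℕ) (F : Factor v k) → Dec (IsHoleyFactor h F)
isHoleyFactor? h = isCycleFactorOn? (λ x → ¬? (toℕ x <? h))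

filter-filter-⊆ : {a p q : Level} {A : Set a} {P : Pred A p} {Q : Pred A q}
                  (P? : Decidable P) (Q? : Decidable Q) →
                  P ⊆ Q → ∀ xs → filter P? (filter Q? xs) ≡ filter P? xs
filter-filter-⊆ P? Q? P⊆Q [] = refl
filter-filter-⊆ P? Q? P⊆Q (x ∷ xs) with Q? x
... | no ¬q = trans (filter-filter-⊆ P? Q? P⊆Q xs) (sym (filter-reject P? (¬q ∘ P⊆Q)))
... | yes _ with P? x
...   | yes _ = cong (x ∷_) (filter-filter-⊆ P? Q? P⊆Q xs)
...   | no _  = filter-filter-⊆ P? Q? P⊆Q xs

Incident : Fin v → Pred (Fin v × Fin v) 0ℓ
Incident x (a , b) = a ≡ x ⊎ b ≡ x

incident? : (x : Fin v) → Decidable (Incident x)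
incident? x (a , b) = (a ≟ x) ⊎-dec (b ≟ x)

sameEdge⇒incident : (x y : Fin v) → SameEdge x y ⊆ Incident x
sameEdge⇒incident x y (inj₁ (a≡x , _)) = inj₁ a≡x
sameEdge⇒incident x y (inj₂ (_ , b≡x)) = inj₂ b≡x

edgeCount-incident : (x y : Fin v) (es : List (Fin v × Fin v)) →
                     edgeCount x y (filter (incident? x) es) ≡ edgeCount x y es
edgeCount-incident x y es =
  cong length (filter-filter-⊆ (sameEdge? x y) (incident? x) (sameEdge⇒incident x y) es)

HoleyMultiplicity : ℕ → Fin v → Fin v → ℕ → Set
HoleyMultiplicity h x y n =
  (x ≢ y → ¬ (InHole h x × InHole h y) → n ≡ 1) × (InHole h x → InHole h y → n ≡ 0)

holeyMultiplicity? : (h : ℕ) (x y : Fin v) (n : ℕ) → Dec (HoleyMultiplicity h x y n)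
holeyMultiplicity? h x y n =
  (¬? (x ≟ y) →-dec (¬? (inHole? x ×-dec inHole? y) →-dec (n ℕ.≟ 1))) ×-dec
  (inHole? x →-dec (inHole? y →-dec (n ℕ.≟ 0)))
  where
  inHole? : (z : Fin v) → Dec (InHole h z)
  inHole? z = toℕ z <? h

PartitionsHoleyComplement : ℕ → List (Fin v × Fin v) → Set
PartitionsHoleyComplement h es = ∀ x y → HoleyMultiplicity h x y (edgeCount x y es)

-- Counting among the edges incident to x, filtered once per x, keeps the check fast.
partitionsHoleyComplement? : (h : ℕ) (es : List (Fin v × Fin v)) → Dec (PartitionsHoleyComplement h es)
partitionsHoleyComplement? h es = all? λ x → map′
  (λ ok y → subst (HoleyMultiplicity h x y) (edgeCount-incident x y es) (ok y))
  (λ ok y → subst (HoleyMultiplicity h x y) (sym (edgeCount-incident x y es)) (ok y))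
  (rowOn x (filter (incident? x) es))
  where
  rowOn : (x : Fin _) (L : List (Fin _ × Fin _)) → Dec (∀ y → HoleyMultiplicity h x y (edgeCount x y L))
  rowOn x L = all? λ y → holeyMultiplicity? h x y (edgeCount x y L)

-- Fin (m * n) is read as levels × ℤₙ, vertex n ℓ + r being (ℓ , r); rotate i adds i in ℤₙ.
module _ {m n : ℕ} .{{_ : NonZero n}} where

  rotate : ℕ → Fin (m * n) → Fin (m * n)
  rotate i x with remQuot {m} n x
  ... | level , r = combine level ((toℕ r + i) mod n)

  rotateFactor : ℕ → Factor (m * n) k → Factor (m * n) k
  rotateFactor i = map (Vec.map (rotate i))

  orbit : (c : ℕ) → Factor (m * n) k → Vec (Factor (m * n) k) c
  orbit c F = tabulate λ i → rotateFactor (toℕ i) F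

fullBase : Factor 45 3
fullBase =
  (# 0 ∷ # 30 ∷ # 39 ∷ []) ∷
  (# 1 ∷ # 41 ∷ # 36 ∷ []) ∷
  (# 2 ∷ # 44 ∷ # 28 ∷ []) ∷
  (# 3 ∷ # 16 ∷ # 26 ∷ []) ∷
  (# 4 ∷ # 32 ∷ # 40 ∷ []) ∷
  (# 5 ∷ # 17 ∷ # 38 ∷ []) ∷
  (# 6 ∷ # 24 ∷ # 37 ∷ []) ∷
  (# 7 ∷ # 29 ∷ # 33 ∷ []) ∷
  (# 8 ∷ # 22 ∷ # 23 ∷ []) ∷
  (# 9 ∷ # 25 ∷ # 43 ∷ []) ∷
  (# 10 ∷ # 19 ∷ # 27 ∷ []) ∷
  (# 11 ∷ # 15 ∷ # 21 ∷ []) ∷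
  (# 12 ∷ # 34 ∷ # 35 ∷ []) ∷
  (# 13 ∷ # 18 ∷ # 42 ∷ []) ∷
  (# 14 ∷ # 31 ∷ # 20 ∷ []) ∷
  []

holeyBase₁ : Factor 45 3
holeyBase₁ =
  (# 16 ∷ # 30 ∷ # 41 ∷ []) ∷
  (# 19 ∷ # 33 ∷ # 44 ∷ []) ∷
  (# 22 ∷ # 36 ∷ # 32 ∷ []) ∷
  (# 25 ∷ # 39 ∷ # 35 ∷ []) ∷
  (# 28 ∷ # 42 ∷ # 38 ∷ []) ∷
  (# 21 ∷ # 23 ∷ # 43 ∷ []) ∷
  (# 24 ∷ # 26 ∷ # 31 ∷ []) ∷
  (# 27 ∷ # 29 ∷ # 34 ∷ []) ∷
  (# 15 ∷ # 17 ∷ # 37 ∷ []) ∷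
  (# 18 ∷ # 20 ∷ # 40 ∷ []) ∷
  []

holeyBase₂ : Factor 45 3
holeyBase₂ =
  (# 38 ∷ # 21 ∷ # 36 ∷ []) ∷
  (# 41 ∷ # 24 ∷ # 39 ∷ []) ∷
  (# 44 ∷ # 27 ∷ # 42 ∷ []) ∷
  (# 32 ∷ # 15 ∷ # 30 ∷ []) ∷
  (# 35 ∷ # 18 ∷ # 33 ∷ []) ∷
  (# 43 ∷ # 20 ∷ # 16 ∷ []) ∷
  (# 31 ∷ # 23 ∷ # 19 ∷ []) ∷
  (# 34 ∷ # 26 ∷ # 22 ∷ []) ∷
  (# 37 ∷ # 29 ∷ # 25 ∷ []) ∷
  (# 40 ∷ # 17 ∷ # 28 ∷ []) ∷
  []

pentagons : Factor 45 5
pentagons = map (λ x → tabulate λ j → rotate {3} {15} (3 * toℕ j) x)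
                (# 15 ∷ # 16 ∷ # 17 ∷ # 30 ∷ # 31 ∷ # 32 ∷ [])

fullFactors : Vec (Factor 45 3) 15
fullFactors = orbit {3} {15} 15 fullBase

holeyTriangleFactors : Vec (Factor 45 3) 6
holeyTriangleFactors = orbit {3} {15} 3 holeyBase₁ ++ᵥ orbit {3} {15} 3 holeyBase₂

holeyPentagonFactors : Vec (Factor 45 5) 1
holeyPentagonFactors = pentagons ∷ []

lemma2p3 : IHW 45 15 3 5 15 0 6 1
lemma2p3 = record
  { count-full   = refl
  ; count-holey  = refl
  ; mFactors     = fullFactors
  ; nFactors     = []
  ; mHoley       = holeyTriangleFactors
  ; nHoley       = holeyPentagonFactors
  ; mFactors-ok  = toWitness {a? = All.all? isFactor? (toList fullFactors)} tt
  ; nFactors-ok  = []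
  ; mHoley-ok    = toWitness {a? = All.all? (isHoleyFactor? 15) (toList holeyTriangleFactors)} tt
  ; nHoley-ok    = toWitness {a? = All.all? (isHoleyFactor? 15) (toList holeyPentagonFactors)} tt
  ; outside-hole = λ x y → proj₁ (partition x y)
  ; inside-hole  = λ x y → proj₂ (partition x y)
  }
  where
  edges : List (Fin 45 × Fin 45)
  edges = concatMap factorEdges (toList fullFactors ++ toList holeyTriangleFactors)
       ++ concatMap factorEdges (toList holeyPentagonFactors)

  partition : PartitionsHoleyComplement 15 edges
  partition = toWitness {a? = partitionsHoleyComplement? 15 edges} tt
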